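{- Let $G=(V,E)$ be a connected locally connected graph, let $z\in V$, and let $a\in V\setminus\{z\}$ be such that $|[a]_z|\geq 2$ and there is a vertex $v\in V$, $v\neq z,a$, with $zav\in\mathcal{B}_G$. Then there is a vertex $u\in N(a)$ such that $[a]_z\subseteq N(u)\cap N(z)$ and, for each $b\in[a]_z$, $zbu\in\mathcal{B}_G$.
   Context: A connected graph $G$ is locally connected if for every vertex $v$ the subgraph induced by its neighborhood $N(v)$ is connected. $d_G$ is the shortest-path distance. For distinct vertices $a,b$, the line $\overline{ab}$ is the set of vertices $c$ such that some shortest path contains $a,b,c$. The betweenness relation is $\mathcal{B}_G=\{(a,b,c)\in V^3 : |\{a,b,c\}|=3,\ d_G(a,c)=d_G(a,b)+d_G(b,c)\}$, and the triple $(a,b,c)$ is written $abc$. For a vertex $z$ and $u\neq z$, $[u]_z=\{w\in V\setminus\{z\}:\overline{zw}=\overline{zu}\}$. -}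

module Defs where

open import Data.Nat using (ℕ; zero; suc; _+_; _≤_)
open import Data.Fin using (Fin)
open import Data.Product using (Σ; ∃; _×_; _,_)
open import Data.Sum using (_⊎_)
open import Relation.Nullary using (¬_; Dec)
open import Relation.Binary.PropositionalEquality using (_≡_; _≢_)
open import Function.Bundles using (_⇔_)

record Graph (n : ℕ) : Set₁ where
  field
    Adj    : Fin n → Fin n → Set
    adj?   : (x y : Fin n) → Dec (Adj x y)
    sym    : ∀ {x y} → Adj x y → Adj y x
    irrefl : ∀ {x} → ¬ Adj x x

module _ {n : ℕ} (G : Graph n) where
  open Graph G

  N : Fin n → Fin n → Set
  N v w = Adj v w

  data WalkIn (P : Fin n → Set) : Fin n → Fin n → ℕ → Set where
    nil  : ∀ {x} → P x → WalkIn P x x zero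
    cons : ∀ {x y z k} → P x → Adj x y → WalkIn P y z k → WalkIn P x z (suc k)

  Walk : Fin n → Fin n → ℕ → Set
  Walk = WalkIn (λ _ → Fin n)

  Connected : Set
  Connected = ∀ x y → ∃ λ k → Walk x y k

  LocallyConnected : Set
  LocallyConnected = ∀ v x y → N v x → N v y → ∃ λ k → WalkIn (N v) x y k

  Dist : Fin n → Fin n → ℕ → Set
  Dist x y k = Walk x y k × (∀ m → Walk x y m → k ≤ m)

  Betw : Fin n → Fin n → Fin n → Set
  Betw a b c = a ≢ b × b ≢ c × a ≢ c ×
    Σ ℕ λ dab → Σ ℕ λ dbc → Σ ℕ λ dac →
      Dist a b dab × Dist b c dbc × Dist a c dac × dac ≡ dab + dbc

  -- c ∈ line ab : some shortest path contains a, b, c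
  InLine : Fin n → Fin n → Fin n → Set
  InLine a b c = c ≡ a ⊎ c ≡ b ⊎ Betw c a b ⊎ Betw a c b ⊎ Betw a b c

  InClass : Fin n → Fin n → Fin n → Set
  InClass z u w = w ≢ z × (∀ c → InLine z w c ⇔ InLine z u c)

{-# OPTIONS --safe #-}
module Submission where

-- Put k = d(z,a). Local connectivity at a yields an ascent: an edge xy inside N(a) with
-- d(z,x) = k and d(z,y) = k + 1, found where a walk in N(a), from a neighbour of a closer to z
-- to one farther from z, crosses level k. Then y lies on the line za and x does not, hence the
-- same holds for the line zb of every b ∈ [a]_z. Comparing distances to x and y rules out
-- z–a–b; it also rules out z–b–a, since then b has an ascent of its own and a lies beyond b.
-- So a–z–b, which forces d(z,b) = 1 and z–b–y. The same argument for the pair (b, a) gives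
-- d(z,a) = 1, so every member of [a]_z is adjacent to z and to y and lies between them.

open import Defs
open import Data.Nat using (ℕ; zero; suc; _+_; _≤_; _<_; s≤s; z<s)
open import Data.Nat.Properties hiding (_≟_)
open import Data.Nat.Induction using (<-rec)
open import Data.Fin using (Fin; _≟_)
open import Data.Fin.Properties using (any?)
open import Data.Product using (Σ; ∃; ∃₂; _×_; _,_; proj₁; proj₂; uncurry)
open import Data.Sum using (inj₁; inj₂; _⊎_) renaming (map to ⊎-map)
open import Data.Empty using (⊥-elim)
open import Function using (_∘_; case_of_)
open import Function.Bundles using (_⇔_; mk⇔; Equivalence)
import Function.Properties.Equivalence as ⇔
open import Relation.Nullary using (¬_; Dec; yes; no; contradiction)
open import Relation.Nullary.Decidable using (_×-dec_)
open import Relation.Binary.PropositionalEquality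
  using (_≡_; _≢_; refl; sym; trans; subst; cong; cong₂; ≢-sym; module ≡-Reasoning)

m≤k<n≤1+m⇒m≡k∧n≡1+k : ∀ {m k n} → m ≤ k → k < n → n ≤ suc m → m ≡ k × n ≡ suc k
m≤k<n≤1+m⇒m≡k∧n≡1+k m≤k k<n n≤1+m =
  ≤-antisym m≤k (≤-pred (≤-trans k<n n≤1+m)) , ≤-antisym (≤-trans n≤1+m (s≤s m≤k)) k<n

k+l≤1+m∧1+k≡l+m⇒l≡1 : ∀ {k l m} → 0 < l → k + l ≤ suc m → suc k ≡ l + m → l ≡ 1
k+l≤1+m∧1+k≡l+m⇒l≡1 {l = suc zero} _ _ _ = refl
k+l≤1+m∧1+k≡l+m⇒l≡1 {k} {suc (suc l)} {m} _ k+l≤1+m 1+k≡l+m = ⊥-elim (<-irrefl refl (begin-strict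
  suc m           ≤⟨ s≤s (m≤n+m m l) ⟩
  suc (l + m)     ≡⟨ suc-injective 1+k≡l+m ⟨
  k               <⟨ m<m+n k z<s ⟩
  k + suc (suc l) ≤⟨ k+l≤1+m ⟩
  suc m           ∎))
  where open ≤-Reasoning

one-of-two-avoids : ∀ {n} {P : Fin n → Set} {b₁ b₂} (a : Fin n) →
  b₁ ≢ b₂ → P b₁ → P b₂ → ∃ λ b → b ≢ a × P b
one-of-two-avoids {b₁ = b₁} a b₁≢b₂ p₁ p₂ with b₁ ≟ a
... | yes refl = _ , ≢-sym b₁≢b₂ , p₂
... | no b₁≢a  = _ , b₁≢a , p₁

module Walks {n : ℕ} (G : Graph n) where
  open Graph G renaming (sym to Adj-sym)

  [] : ∀ {x} → Walk G x x 0
  [] {x} = nil x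

  step : ∀ {x y w m} → Adj x y → Walk G y w m → Walk G x w (suc m)
  step {x} = cons x

  _++_ : ∀ {x y w m k} → Walk G x y m → Walk G y w k → Walk G x w (m + k)
  nil _      ++ q = q
  cons _ e p ++ q = step e (p ++ q)

  snoc : ∀ {x y w m} → Walk G x y m → Adj y w → Walk G x w (suc m)
  snoc (nil _)      e = step e []
  snoc (cons _ e p) f = step e (snoc p f)

  reverse : ∀ {x y m} → Walk G x y m → Walk G y x m
  reverse (nil _)      = []
  reverse (cons _ e p) = snoc (reverse p) (Adj-sym e)

  walk? : ∀ m x y → Dec (Walk G x y m)
  walk? zero x y with x ≟ y
  ... | yes refl = yes []
  ... | no x≢y   = no λ { (nil _) → x≢y refl }
  walk? (suc m) x y with any? (λ w → adj? x w ×-dec walk? m w y)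
  ... | yes (_ , e , p) = yes (step e p)
  ... | no ∄w           = no λ { (cons _ e p) → ∄w (_ , e , p) }

  head : ∀ {P x y m} → WalkIn G P x y m → P x
  head (nil px)      = px
  head (cons px _ _) = px

  crossing : ∀ {P s t m} (f : Fin n → ℕ) K → WalkIn G P s t m → f s ≤ K → K < f t →
    ∃₂ λ x y → P x × P y × Adj x y × f x ≤ K × K < f y
  crossing f K (nil _) fs≤K K<ft = contradiction fs≤K (<⇒≱ K<ft)
  crossing f K (cons {y = y} px e p) fs≤K K<ft with f y ≤? K
  ... | yes fy≤K = crossing f K p fy≤K K<ft
  ... | no fy≰K  = _ , _ , px , head p , e , fs≤K , ≰⇒> fy≰K

module Distance {n : ℕ} (G : Graph n) (connected : Connected G) where
  open Graph G renaming (sym to Adj-sym)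
  open Walks G

  shortest : ∀ {x y} m → Walk G x y m → ∃ (Dist G x y)
  shortest {x} {y} = <-rec _ λ m shorter p →
    case anyUpTo? (λ k → walk? k x y) m of λ where
      (yes (k , k<m , q)) → shorter k<m q
      (no ∄q)             → m , p , λ k q → ≮⇒≥ λ k<m → ∄q (k , k<m , q)

  opaque
    d : Fin n → Fin n → ℕ
    d x y = proj₁ (uncurry shortest (connected x y))

    d-dist : ∀ x y → Dist G x y (d x y)
    d-dist x y = proj₂ (uncurry shortest (connected x y))

  d-minimal : ∀ {x y m} → Walk G x y m → d x y ≤ m
  d-minimal {x} {y} = proj₂ (d-dist x y) _

  geodesic : ∀ x y → Walk G x y (d x y)
  geodesic x y = proj₁ (d-dist x y)

  Dist⇒≡d : ∀ {x y m} → Dist G x y m → m ≡ d x y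
  Dist⇒≡d (p , minimal) = ≤-antisym (minimal _ (geodesic _ _)) (d-minimal p)

  d-refl : ∀ x → d x x ≡ 0
  d-refl x = n≤0⇒n≡0 (d-minimal [])

  d≡0⇒≡ : ∀ {x y} → d x y ≡ 0 → x ≡ y
  d≡0⇒≡ eq with subst (Walk G _ _) eq (geodesic _ _)
  ... | nil _ = refl

  ≢⇒d>0 : ∀ {x y} → x ≢ y → 0 < d x y
  ≢⇒d>0 x≢y = n≢0⇒n>0 (x≢y ∘ d≡0⇒≡)

  d-sym : ∀ x y → d x y ≡ d y x
  d-sym x y = ≤-antisym (d-minimal (reverse (geodesic y x))) (d-minimal (reverse (geodesic x y)))

  d-triangle : ∀ x y w → d x w ≤ d x y + d y w
  d-triangle x y w = d-minimal (geodesic x y ++ geodesic y w)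

  Adj⇒d≡1 : ∀ {x y} → Adj x y → d x y ≡ 1
  Adj⇒d≡1 e = ≤-antisym (d-minimal (step e [])) (≢⇒d>0 λ { refl → irrefl e })

  d≡1⇒Adj : ∀ {x y} → d x y ≡ 1 → Adj x y
  d≡1⇒Adj eq with subst (Walk G _ _) eq (geodesic _ _)
  ... | cons _ e (nil _) = e

  d-stepˡ : ∀ {x y} w → Adj x y → d x w ≤ suc (d y w)
  d-stepˡ {x} {y} w e = ≤-trans (d-triangle x y w) (≤-reflexive (cong (_+ d y w) (Adj⇒d≡1 e)))

  d-stepʳ : ∀ {x y} w → Adj x y → d w y ≤ suc (d w x)
  d-stepʳ {x} {y} w e = begin
    d w y       ≡⟨ d-sym w y ⟩
    d y w       ≤⟨ d-stepˡ w (Adj-sym e) ⟩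
    suc (d x w) ≡⟨ cong suc (d-sym x w) ⟩
    suc (d w x) ∎
    where open ≤-Reasoning

  first-step : ∀ {x y m} → x ≢ y → Dist G x y m → ∃ λ p → Adj x p × suc (d p y) ≡ m
  first-step x≢y (nil _ , _) = contradiction refl x≢y
  first-step _ (cons _ e p , minimal) =
    _ , e , ≤-antisym (s≤s (d-minimal p)) (minimal _ (step e (geodesic _ _)))

  Between : Fin n → Fin n → Fin n → Set
  Between a b c = d a c ≡ d a b + d b c

  Between-reflˡ : ∀ a c → Between a a c
  Between-reflˡ a c = cong (_+ d a c) (sym (d-refl a))

  Between-reflʳ : ∀ a c → Between a c c
  Between-reflʳ a c = sym (trans (cong (d a c +_) (d-refl c)) (+-identityʳ (d a c)))

  Between-reverse : ∀ {a b c} → Between a b c → Between c b a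
  Between-reverse {a} {b} {c} abc = begin
    d c a         ≡⟨ d-sym c a ⟩
    d a c         ≡⟨ abc ⟩
    d a b + d b c ≡⟨ +-comm (d a b) (d b c) ⟩
    d b c + d a b ≡⟨ cong₂ _+_ (d-sym b c) (d-sym a b) ⟩
    d c b + d b a ∎
    where open ≡-Reasoning

  Betw⇒Between : ∀ {a b c} → Betw G a b c → Between a b c
  Betw⇒Between (_ , _ , _ , _ , _ , _ , ab , bc , ac , eq) =
    trans (sym (Dist⇒≡d ac)) (trans eq (cong₂ _+_ (Dist⇒≡d ab) (Dist⇒≡d bc)))

  Between⇒Betw : ∀ {a b c} → a ≢ b → b ≢ c → a ≢ c → Between a b c → Betw G a b c
  Between⇒Betw {a} {b} {c} a≢b b≢c a≢c abc =
    a≢b , b≢c , a≢c , _ , _ , _ , d-dist a b , d-dist b c , d-dist a c , abc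

  Between-1+1 : ∀ {a b c} → d a b ≡ 1 → d a c ≡ 2 → Between a b c →
    Adj a b × Adj b c × Betw G a b c
  Between-1+1 {a} {b} {c} ab≡1 ac≡2 abc =
    d≡1⇒Adj ab≡1 , d≡1⇒Adj bc≡1 ,
    Between⇒Betw (distinct ab≡1) (distinct bc≡1) (distinct ac≡2) abc
    where
    bc≡1 : d b c ≡ 1
    bc≡1 = +-cancelˡ-≡ 1 (d b c) 1 (trans (cong (_+ d b c) (sym ab≡1)) (trans (sym abc) ac≡2))
    distinct : ∀ {x y k} → d x y ≡ suc k → x ≢ y
    distinct {x} eq refl = 0≢1+n (trans (sym (d-refl x)) eq)

  -- c ∈ line ab; the cases c = a and c = b are degenerate instances of the first two disjuncts.
  Collinear : Fin n → Fin n → Fin n → Set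
  Collinear a b c = Between c a b ⊎ Between a c b ⊎ Between a b c

  InLine⇒Collinear : ∀ {a b c} → InLine G a b c → Collinear a b c
  InLine⇒Collinear {a} {b} (inj₁ refl)                = inj₁ (Between-reflˡ a b)
  InLine⇒Collinear {a} {b} (inj₂ (inj₁ refl))         = inj₂ (inj₁ (Between-reflʳ a b))
  InLine⇒Collinear (inj₂ (inj₂ cab-or-acb-or-abc)) =
    ⊎-map Betw⇒Between (⊎-map Betw⇒Between Betw⇒Between) cab-or-acb-or-abc

  Collinear⇒InLine : ∀ {a b c} → a ≢ b → Collinear a b c → InLine G a b c
  Collinear⇒InLine {a} {b} {c} a≢b col with c ≟ a | c ≟ b
  ... | yes c≡a | _       = inj₁ c≡a
  ... | no _    | yes c≡b = inj₂ (inj₁ c≡b)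
  ... | no c≢a  | no c≢b  = inj₂ (inj₂ (⊎-map
    (Between⇒Betw c≢a a≢b c≢b)
    (⊎-map (Between⇒Betw (≢-sym c≢a) c≢b a≢b) (Between⇒Betw a≢b (≢-sym c≢b) (≢-sym c≢a)))
    col))

  Twins : Fin n → Fin n → Fin n → Set
  Twins z a b = ∀ c → Collinear z a c ⇔ Collinear z b c

  InClass⇒Twins : ∀ {z a b} → a ≢ z → InClass G z a b → Twins z a b
  InClass⇒Twins a≢z (b≢z , same-line) c = mk⇔
    (InLine⇒Collinear ∘ Equivalence.from (same-line c) ∘ Collinear⇒InLine (≢-sym a≢z))
    (InLine⇒Collinear ∘ Equivalence.to (same-line c) ∘ Collinear⇒InLine (≢-sym b≢z))

  Twins-sym : ∀ {z a b} → Twins z a b → Twins z b a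
  Twins-sym twins c = ⇔.sym (twins c)

module Ascents {n : ℕ} (G : Graph n) (connected : Connected G)
               (locally-connected : LocallyConnected G) where
  open Graph G renaming (sym to Adj-sym)
  open Walks G
  open Distance G connected

  descending-neighbour : ∀ {z a} → a ≢ z → ∃ λ q → Adj a q × d z q < d z a
  descending-neighbour {z} {a} a≢z with first-step a≢z (d-dist a z)
  ... | q , e , q-closer = q , e , (begin-strict
    d z q       ≡⟨ d-sym z q ⟩
    d q z       <⟨ n<1+n (d q z) ⟩
    suc (d q z) ≡⟨ q-closer ⟩
    d a z       ≡⟨ d-sym a z ⟩
    d z a       ∎)
    where open ≤-Reasoning

  ascending-neighbour : ∀ {z a v} → a ≢ v → Between z a v → ∃ λ p → Adj a p × d z a < d z p
  ascending-neighbour {z} {a} {v} a≢v zav with first-step a≢v (d-dist a v)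
  ... | p , e , p-closer = p , e , +-cancelʳ-≤ (d p v) (suc (d z a)) (d z p) (begin
    suc (d z a) + d p v ≡⟨ +-suc (d z a) (d p v) ⟨
    d z a + suc (d p v) ≡⟨ cong (d z a +_) p-closer ⟩
    d z a + d a v       ≡⟨ zav ⟨
    d z v               ≤⟨ d-triangle z p v ⟩
    d z p + d p v       ∎)
    where open ≤-Reasoning

  record Ascent (z a : Fin n) : Set where
    constructor mkAscent
    field
      x y     : Fin n
      ax      : Adj a x
      ay      : Adj a y
      xy      : Adj x y
      x-level : d z x ≡ d z a
      y-level : d z y ≡ suc (d z a)

  ascent : ∀ {z a v} → a ≢ z → a ≢ v → Between z a v → Ascent z a
  ascent {z} {a} a≢z a≢v zav with descending-neighbour a≢z | ascending-neighbour a≢v zav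
  ... | q , aq , q-below | p , ap , p-above with locally-connected a q p aq ap
  ... | _ , q⇝p with crossing (d z) (d z a) q⇝p (<⇒≤ q-below) p-above
  ... | x , y , ax , ay , xy , x≤ , <y with m≤k<n≤1+m⇒m≡k∧n≡1+k x≤ <y (d-stepʳ z xy)
  ... | x-level , y-level = mkAscent x y ax ay xy x-level y-level

  module _ {z a} (A : Ascent z a) where
    open Ascent A

    Ascent⇒≢ : a ≢ z
    Ascent⇒≢ refl = irrefl (subst (Adj a) (sym (d≡0⇒≡ (trans x-level (d-refl a)))) ax)

    private
      a>z : 0 < d z a
      a>z = ≢⇒d>0 (≢-sym Ascent⇒≢)

    top-beyond : Between z a y
    top-beyond = trans y-level (trans (+-comm 1 (d z a)) (cong (d z a +_) (sym (Adj⇒d≡1 ay))))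

    base-off-line : ¬ Collinear z a x
    base-off-line (inj₁ xza) = <⇒≢ (+-mono-≤ a>z a>z)
      (trans (sym (Adj⇒d≡1 (Adj-sym ax))) (trans xza (cong (_+ d z a) (trans (d-sym x z) x-level))))
    base-off-line (inj₂ (inj₁ zxa)) =
      m+1+n≢m (d z a) (sym (trans zxa (cong₂ _+_ x-level (Adj⇒d≡1 (Adj-sym ax)))))
    base-off-line (inj₂ (inj₂ zax)) =
      m+1+n≢m (d z a) (trans (cong (d z a +_) (sym (Adj⇒d≡1 ax))) (trans (sym zax) x-level))

    module _ {b} (twins : Twins z a b) where
      open ≤-Reasoning

      private
        y-on-line : Collinear z b y
        y-on-line = Equivalence.to (twins y) (inj₂ (inj₂ top-beyond))

        x-off-line : ¬ Collinear z b x
        x-off-line = base-off-line ∘ Equivalence.from (twins x)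

        y-dist : d y z ≡ suc (d z a)
        y-dist = trans (d-sym y z) y-level

      twin≢z : b ≢ z
      twin≢z refl = x-off-line (inj₁ (Between-reflʳ x z))

      twin-not-beyond : a ≢ b → ¬ Between z a b
      twin-not-beyond a≢b zab = x-off-line (inj₂ (inj₁ zxb))
        where
        dxb≡dab : Collinear z b y → d x b ≡ d a b
        dxb≡dab (inj₁ yzb) = ⊥-elim (<-irrefl refl (begin-strict
          suc (d a b)         ≤⟨ m<n+m (d a b) a>z ⟩
          d z a + d a b       ≡⟨ zab ⟨
          d z b               ≤⟨ m≤n+m (d z b) (d z a) ⟩
          d z a + d z b       <⟨ n<1+n _ ⟩
          suc (d z a) + d z b ≡⟨ cong (_+ d z b) y-dist ⟨
          d y z + d z b       ≡⟨ yzb ⟨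
          d y b               ≤⟨ d-stepˡ b (Adj-sym ay) ⟩
          suc (d a b)         ∎))
        dxb≡dab (inj₂ (inj₁ zyb)) = ≤-antisym
          (begin
            d x b       ≤⟨ d-stepˡ b xy ⟩
            suc (d y b) ≡⟨ dab≡ ⟨
            d a b       ∎)
          (+-cancelˡ-≤ (d z a) (d a b) (d x b) (begin
            d z a + d a b ≡⟨ zab ⟨
            d z b         ≤⟨ d-triangle z x b ⟩
            d z x + d x b ≡⟨ cong (_+ d x b) x-level ⟩
            d z a + d x b ∎))
          where
          dab≡ : d a b ≡ suc (d y b)
          dab≡ = +-cancelˡ-≡ (d z a) (d a b) (suc (d y b)) (begin-equality
            d z a + d a b       ≡⟨ zab ⟨
            d z b               ≡⟨ zyb ⟩
            d z y + d y b       ≡⟨ cong (_+ d y b) y-level ⟩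
            suc (d z a) + d y b ≡⟨ +-suc (d z a) (d y b) ⟨
            d z a + suc (d y b) ∎)
        dxb≡dab (inj₂ (inj₂ zby)) = begin-equality
          d x b ≡⟨ cong (d x) b≡y ⟩
          d x y ≡⟨ Adj⇒d≡1 xy ⟩
          1     ≡⟨ Adj⇒d≡1 ay ⟨
          d a y ≡⟨ cong (d a) b≡y ⟨
          d a b ∎
          where
          b≡y : b ≡ y
          b≡y = d≡0⇒≡ (n≤0⇒n≡0 (+-cancelˡ-≤ (d z b) (d b y) 0 (begin
            d z b + d b y ≡⟨ zby ⟨
            d z y         ≡⟨ y-level ⟩
            suc (d z a)   ≤⟨ m<m+n (d z a) (≢⇒d>0 a≢b) ⟩
            d z a + d a b ≡⟨ zab ⟨
            d z b         ≡⟨ +-identityʳ (d z b) ⟨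
            d z b + 0     ∎)))
        zxb : Between z x b
        zxb = trans zab (cong₂ _+_ (sym x-level) (sym (dxb≡dab y-on-line)))

      twin-behind : Between a z b → d z b ≡ 1 × Between z b y
      twin-behind azb = lift y-on-line
        where
        dab≡ : d a b ≡ d z a + d z b
        dab≡ = trans azb (cong (_+ d z b) (d-sym a z))
        dxz≡ : d x z ≡ d z a
        dxz≡ = trans (d-sym x z) x-level
        dxb< : d x b < d z a + d z b
        dxb< = ≤∧≢⇒<
          (begin
            d x b         ≤⟨ d-triangle x z b ⟩
            d x z + d z b ≡⟨ cong (_+ d z b) dxz≡ ⟩
            d z a + d z b ∎)
          (λ xzb → x-off-line (inj₁ (trans xzb (cong (_+ d z b) (sym dxz≡)))))
        lift : Collinear z b y → d z b ≡ 1 × Between z b y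
        lift (inj₁ yzb) = ⊥-elim (<-irrefl refl (begin-strict
          d z a + d z b       <⟨ n<1+n _ ⟩
          suc (d z a) + d z b ≡⟨ cong (_+ d z b) y-dist ⟨
          d y z + d z b       ≡⟨ yzb ⟨
          d y b               ≤⟨ d-stepˡ b (Adj-sym xy) ⟩
          suc (d x b)         ≤⟨ dxb< ⟩
          d z a + d z b       ∎))
        lift (inj₂ (inj₁ zyb)) = ⊥-elim (<-irrefl refl (begin-strict
          suc (d y b)         <⟨ s≤s (m<n+m (d y b) a>z) ⟩
          suc (d z a) + d y b ≡⟨ cong (_+ d y b) y-level ⟨
          d z y + d y b       ≡⟨ zyb ⟨
          d z b               ≤⟨ m≤n+m (d z b) (d z a) ⟩
          d z a + d z b       ≡⟨ dab≡ ⟨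
          d a b               ≤⟨ d-stepˡ b ay ⟩
          suc (d y b)         ∎))
        lift (inj₂ (inj₂ zby)) = k+l≤1+m∧1+k≡l+m⇒l≡1 (≢⇒d>0 (≢-sym twin≢z))
          (begin
            d z a + d z b ≡⟨ dab≡ ⟨
            d a b         ≤⟨ d-stepˡ b ay ⟩
            suc (d y b)   ≡⟨ cong suc (d-sym y b) ⟩
            suc (d b y)   ∎)
          (trans (sym y-level) zby) , zby

  twin-opposite : ∀ {z a b} → Ascent z a → Twins z a b → a ≢ b → Between a z b
  twin-opposite {z} {a} {b} A twins a≢b with Equivalence.to (twins a) (inj₂ (inj₁ (Between-reflʳ z a)))
  ... | inj₁ azb        = azb
  ... | inj₂ (inj₁ zab) = ⊥-elim (twin-not-beyond A twins a≢b zab)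
  ... | inj₂ (inj₂ zba) = ⊥-elim (twin-not-beyond B (Twins-sym twins) (≢-sym a≢b) zba)
    where
    B : Ascent z b
    B = ascent (twin≢z A twins) (≢-sym a≢b) zba

  module _ {z a} (A : Ascent z a) where
    open Ascent A

    private
      twins-of : ∀ {b} → InClass G z a b → Twins z a b
      twins-of = InClass⇒Twins (Ascent⇒≢ A)

    twin-at-level-one : ∀ {b} → InClass G z a b → b ≢ a → d z b ≡ 1 × Between z b y
    twin-at-level-one cl b≢a = twin-behind A (twins-of cl) (twin-opposite A (twins-of cl) (≢-sym b≢a))

    nontrivial-class⇒d≡1 : ∀ {b} → InClass G z a b → b ≢ a → d z a ≡ 1
    nontrivial-class⇒d≡1 {b} cl b≢a =
      proj₁ (twin-behind B (Twins-sym (twins-of cl)) (Between-reverse azb))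
      where
      azb : Between a z b
      azb = twin-opposite A (twins-of cl) (≢-sym b≢a)
      b-level : d z b ≡ 1
      b-level = proj₁ (twin-at-level-one cl b≢a)
      b≢y : b ≢ y
      b≢y refl = <⇒≢ (≢⇒d>0 (≢-sym (Ascent⇒≢ A))) (suc-injective (trans (sym b-level) y-level))
      B : Ascent z b
      B = ascent (proj₁ cl) b≢y (proj₂ (twin-at-level-one cl b≢a))

    class-member-under-top : d z a ≡ 1 → ∀ {b} → InClass G z a b → Adj z b × Adj b y × Betw G z b y
    class-member-under-top a-level {b} cl =
      Between-1+1 (proj₁ below-top) (trans y-level (cong suc a-level)) (proj₂ below-top)
      where
      below-top : d z b ≡ 1 × Between z b y
      below-top with b ≟ a
      ... | yes refl = a-level , top-beyond A
      ... | no b≢a   = twin-at-level-one cl b≢a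

lemma2p2 : {n : ℕ} (G : Graph n) → Connected G → LocallyConnected G →
    (z a : Fin n) → a ≢ z →
    (Σ (Fin n) λ b₁ → Σ (Fin n) λ b₂ → b₁ ≢ b₂ × InClass G z a b₁ × InClass G z a b₂) →
    (Σ (Fin n) λ v → v ≢ z × v ≢ a × Betw G z a v) →
    Σ (Fin n) λ u → N G a u ×
      (∀ b → InClass G z a b → N G u b × N G z b) ×
      (∀ b → InClass G z a b → Betw G z b u)
-- v ≢ z and v ≢ a are already part of Betw G z a v.
lemma2p2 G connected locally-connected z a a≢z (_ , _ , b₁≢b₂ , cl₁ , cl₂) (_ , _ , _ , zav) =
  y , ay ,
  (λ b cl → let zb , by , _ = on-top cl in Adj-sym by , zb) ,
  (λ b cl → let _ , _ , zby = on-top cl in zby)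
  where
  open Graph G using (Adj) renaming (sym to Adj-sym)
  open Distance G connected
  open Ascents G connected locally-connected
  A : Ascent z a
  A = ascent a≢z (proj₁ (proj₂ zav)) (Betw⇒Between zav)
  open Ascent A
  on-top : ∀ {b} → InClass G z a b → Adj z b × Adj b y × Betw G z b y
  on-top with one-of-two-avoids a b₁≢b₂ cl₁ cl₂
  ... | _ , b≢a , cl = class-member-under-top A (nontrivial-class⇒d≡1 A cl b≢a)
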